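{- Let $T=\{123,213,231\}$, $k\geq 1$, and $\tau\in S_k(T)$. Then: (i) there exists $r$ with $1\leq r\leq k$ such that $\tau=(k,k-1,\dots,r+1,\;1,\;r,r-1,\dots,2)$; (ii) for every $r$ with $2\leq r\leq k$ and all $n\geq k$, $$|S_n(T,(k,k-1,\dots,r+1,1,r,\dots,2))|=k-1.$$
   Context: Permutations are written in one-line notation (a run such as $k,\dots,r+1$ is empty when $r=k$, and $r,\dots,2$ is empty when $r=1$); $S_k$ is the set of permutations of $\{1,\dots,k\}$. A permutation $\alpha\in S_n$ contains a pattern $\beta$ if some subsequence of $\alpha$ is order-isomorphic to $\beta$; otherwise it avoids $\beta$. $S_n(T,\tau)$ is the set of permutations in $S_n$ avoiding all patterns in $T$ and $\tau$. -}

module Defs where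

open import Data.Nat using (ℕ; zero; suc; _∸_; _<_; _≤_)
open import Data.List using (List; []; _∷_; _++_; map; upTo; length; lookup)
open import Data.List.Relation.Binary.Permutation.Propositional using (_↭_)
open import Data.List.Relation.Binary.Sublist.Propositional using (_⊆_)
open import Data.List.Membership.Propositional using (_∈_)
open import Data.List.Relation.Unary.Unique.Propositional using (Unique)
open import Data.Fin using (cast)
open import Data.Product using (Σ; ∃; _×_)
open import Relation.Nullary using (¬_)
open import Relation.Binary.PropositionalEquality using (_≡_)
open import Function.Bundles using (_⇔_)

IsPerm : ℕ → List ℕ → Set
IsPerm n σ = σ ↭ map suc (upTo n)

OrderIso : List ℕ → List ℕ → Set
OrderIso xs ys =
  Σ (length xs ≡ length ys) λ eq →
    ∀ i j → (lookup xs i < lookup xs j) ⇔ (lookup ys (cast eq i) < lookup ys (cast eq j))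

Contains : List ℕ → List ℕ → Set
Contains α β = ∃ λ s → (s ⊆ α) × OrderIso s β

Avoids : List ℕ → List ℕ → Set
Avoids α β = ¬ Contains α β

p123 p213 p231 : List ℕ
p123 = 1 ∷ 2 ∷ 3 ∷ []
p213 = 2 ∷ 1 ∷ 3 ∷ []
p231 = 2 ∷ 3 ∷ 1 ∷ []

AvoidsT : List ℕ → Set
AvoidsT α = Avoids α p123 × Avoids α p213 × Avoids α p231

-- down a b = a, a-1, ..., b+1  (empty when a ≤ b)
down : ℕ → ℕ → List ℕ
down a b = map (λ i → a ∸ i) (upTo (a ∸ b))

τ : ℕ → ℕ → List ℕ
τ k r = down k r ++ (1 ∷ down r 1)

CardAvoiders : ℕ → List ℕ → ℕ → Set
CardAvoiders n β c =
  ∃ λ (L : List (List ℕ)) →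
    Unique L × (∀ σ → (σ ∈ L) ⇔ (IsPerm n σ × AvoidsT σ × Avoids σ β)) × (length L ≡ c)

{-# OPTIONS --safe #-}

-- A permutation t ∈ Sₙ avoiding T = {123, 213, 231} splits as X 1 Y, where avoiding 231
-- makes X non-increasing, avoiding 123 makes Y non-increasing and avoiding 213 puts X
-- above Y; hence X Y = n, …, 2, so t = blocks p q = (p+q+1, …, q+2, 1, q+1, …, 2), which
-- is τ n (q+1).  Conversely every ascent of blocks p q starts at its entry 1, which no
-- occurrence of 123, 213 or 231 allows.  An occurrence of blocks p′ q′ (q′ ≥ 1) in
-- blocks p q sends the ascent 1 < q′+1 to an ascent, hence 1 to 1, so p′ ≤ p and q′ ≤ q;
-- conversely these inequalities give an occurrence by raising the entries ≥ 2.  So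
-- S_n(T, blocks p′ q′) consists of the blocks p q with p + q = n - 1 and p < p′ or q < q′:
-- p′ + q′ = k - 1 permutations, the two families being disjoint as p′ + q′ ≤ n - 1.
module Submission where

open import Defs
open import Data.Fin using (Fin; zero; suc; cast; #_)
open import Data.List
  using (List; []; _∷_; _++_; [_]; map; upTo; applyUpTo; downFrom; reverse; length; lookup)
open import Data.List.Properties
  using (∷-injective; map-++; length-++; length-map; length-upTo; map-upTo; reverse-map; reverse-upTo)
open import Data.List.Membership.Propositional using (_∈_; _∉_)
open import Data.List.Membership.Propositional.Properties
  using (∈-++⁺ˡ; ∈-++⁺ʳ; ∈-++⁻; ∈-∃++; ∈-map⁺; ∈-map⁻; ∈-upTo⁺; ∈-upTo⁻)
open import Data.List.Relation.Binary.Disjoint.Propositional using (Disjoint)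
open import Data.List.Relation.Binary.Permutation.Propositional
  using (_↭_; ↭-sym; ↭-trans; ↭⇒↭ₛ′; module PermutationReasoning)
open import Data.List.Relation.Binary.Permutation.Propositional.Properties
  using (↭-reverse; shift; ∷↭∷ʳ; drop-∷; ∈-resp-↭; ↭-length)
open import Data.List.Relation.Binary.Pointwise using (Pointwise-≡⇒≡)
open import Data.List.Relation.Binary.Sublist.Propositional
  using (_⊆_; []; _∷_; _∷ʳ_; from∈; minimum; ⊆-refl; ⊆-trans)
open import Data.List.Relation.Binary.Sublist.Propositional.Properties
  using (All-resp-⊆; Any-resp-⊆; ∷⁻; ++⁺; ++⁺ˡ; ++⁺ʳ; length-mono-≤)
open import Data.List.Relation.Unary.All as All using (All; []; _∷_)
import Data.List.Relation.Unary.All.Properties as All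
open import Data.List.Relation.Unary.AllPairs as AllPairs using (AllPairs; []; _∷_)
import Data.List.Relation.Unary.AllPairs.Properties as AllPairs
open import Data.List.Relation.Unary.Any using (here; there)
open import Data.List.Relation.Unary.Sorted.TotalOrder.Properties using (AllPairs⇒Sorted; ↗↭↗⇒≋)
open import Data.List.Relation.Unary.Unique.Propositional using (Unique)
import Data.List.Relation.Unary.Unique.Propositional.Properties as Unique
open import Data.Nat using (ℕ; zero; suc; _+_; _∸_; _≤_; _<_; _≥_; _>_; z≤n; s≤s; z<s; s<s)
open import Data.Nat.Properties
open import Algebra.Properties.CommutativeSemigroup +-commutativeSemigroup
  using (x∙yz≈xz∙y; xy∙z≈xz∙y)
open import Data.Product using (∃; ∃₂; _×_; _,_; proj₁; proj₂)
open import Data.Sum using (_⊎_; inj₁; inj₂; [_,_]′)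
open import Function using (_∘_)
open import Level using (0ℓ)
open import Function.Bundles using (_⇔_; mk⇔; Equivalence)
import Relation.Binary.Construct.Flip.EqAndOrd as Flip
open import Relation.Binary.Bundles using (TotalOrder)
open import Relation.Binary.Definitions using (tri<; tri≈; tri>)
open import Relation.Binary.PropositionalEquality
  using (_≡_; refl; sym; trans; cong; cong₂; subst; subst₂; module ≡-Reasoning)
  renaming (isEquivalence to ≡-isEquivalence)
open import Relation.Nullary using (yes; no; contradiction)

private
  variable
    A : Set
    R : A → A → Set

++-injective : (xs xs′ : List A) {ys ys′ : List A} →
  length xs ≡ length xs′ → xs ++ ys ≡ xs′ ++ ys′ → xs ≡ xs′ × ys ≡ ys′
++-injective []       []        _   eq = refl , eq
++-injective (x ∷ xs) (x′ ∷ xs′) len eq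
  with refl , eq′ ← ∷-injective eq
  with refl , eq″ ← ++-injective xs xs′ (suc-injective len) eq′ = refl , eq″

AllPairs-resp-⊆ : ∀ {xs ys} → xs ⊆ ys → AllPairs R ys → AllPairs R xs
AllPairs-resp-⊆ []        []       = []
AllPairs-resp-⊆ (y ∷ʳ σ)  (_ ∷ rs) = AllPairs-resp-⊆ σ rs
AllPairs-resp-⊆ (refl ∷ σ) (r ∷ rs) = All-resp-⊆ σ r ∷ AllPairs-resp-⊆ σ rs

AllPairs-from-⊆ : ∀ {xs} → (∀ {x y} → x ∷ y ∷ [] ⊆ xs → R x y) → AllPairs R xs
AllPairs-from-⊆ {xs = []}     h = []
AllPairs-from-⊆ {xs = x ∷ xs} h =
  All.tabulate (λ y∈ → h (refl ∷ from∈ y∈)) ∷ AllPairs-from-⊆ (λ σ → h (x ∷ʳ σ))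

AllPairs-pair : ∀ {x y xs} → AllPairs R xs → x ∷ y ∷ [] ⊆ xs → R x y
AllPairs-pair rs σ with (r ∷ []) ∷ _ ← AllPairs-resp-⊆ σ rs = r

⊆-split-at : ∀ {z : A} X {Y xs ys} → z ∉ X → z ∉ Y →
  xs ++ z ∷ ys ⊆ X ++ z ∷ Y → xs ⊆ X × ys ⊆ Y
⊆-split-at []      {xs = []}    z∉X z∉Y (refl ∷ σ) = [] , σ
⊆-split-at []      {xs = []}    z∉X z∉Y (_ ∷ʳ σ)   =
  contradiction (Any-resp-⊆ σ (here refl)) z∉Y
⊆-split-at []      {xs = _ ∷ xs} z∉X z∉Y σ         =
  contradiction (Any-resp-⊆ (∷⁻ σ) (∈-++⁺ʳ xs (here refl))) z∉Y
⊆-split-at (x ∷ X) {xs = []}    z∉X z∉Y (refl ∷ σ) = contradiction (here refl) z∉X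
⊆-split-at (x ∷ X) z∉X z∉Y (_ ∷ʳ σ)
  with xs⊆X , ys⊆Y ← ⊆-split-at X (z∉X ∘ there) z∉Y σ = x ∷ʳ xs⊆X , ys⊆Y
⊆-split-at (x ∷ X) {xs = _ ∷ _} z∉X z∉Y (refl ∷ σ)
  with xs⊆X , ys⊆Y ← ⊆-split-at X (z∉X ∘ there) z∉Y σ = refl ∷ xs⊆X , ys⊆Y

NonIncreasing : List ℕ → Set
NonIncreasing = AllPairs _≥_

≥-totalOrder : TotalOrder 0ℓ 0ℓ 0ℓ
≥-totalOrder = Flip.totalOrder ≤-totalOrder

↭-nonIncreasing⇒≡ : ∀ {xs ys} → NonIncreasing xs → NonIncreasing ys → xs ↭ ys → xs ≡ ys
↭-nonIncreasing⇒≡ xs≥ ys≥ xs↭ys = Pointwise-≡⇒≡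
  (↗↭↗⇒≋ ≥-totalOrder (AllPairs⇒Sorted ≥-totalOrder xs≥)
                       (AllPairs⇒Sorted ≥-totalOrder ys≥)
                       (↭⇒↭ₛ′ ≡-isEquivalence xs↭ys))

lookup-map : ∀ {B : Set} (f : A → B) xs (i : Fin (length (map f xs))) →
  lookup (map f xs) i ≡ f (lookup xs (cast (length-map f xs) i))
lookup-map f (x ∷ xs) zero    = refl
lookup-map f (x ∷ xs) (suc i) = lookup-map f xs i

module _ {f : ℕ → ℕ} (f-mono : ∀ {x y} → x < y → f x < f y) where

  mono⇒reflects-< : ∀ {x y} → f x < f y → x < y
  mono⇒reflects-< {x} {y} fx<fy with <-cmp x y
  ... | tri< x<y _ _ = x<y
  ... | tri≈ _ refl _ = contradiction fx<fy (<-irrefl refl)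
  ... | tri> _ _ y<x = contradiction fx<fy (<-asym (f-mono y<x))

  OrderIso-map : ∀ xs → OrderIso (map f xs) xs
  OrderIso-map xs = length-map f xs , λ i j →
    mk⇔ (λ lt → mono⇒reflects-< (subst₂ _<_ (lookup-map f xs i) (lookup-map f xs j) lt))
        (λ lt → subst₂ _<_ (sym (lookup-map f xs i)) (sym (lookup-map f xs j)) (f-mono lt))

  contains-image : ∀ {α β} → map f β ⊆ α → Contains α β
  contains-image {β = β} fβ⊆α = map f β , fβ⊆α , OrderIso-map β

OrderIso-tail : ∀ {x y xs ys} → OrderIso (x ∷ xs) (y ∷ ys) → OrderIso xs ys
OrderIso-tail (eq , iso) = suc-injective eq , λ i j → iso (suc i) (suc j)

OrderIso-ascent : ∀ {x x′ y y′ xs ys} →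
  OrderIso (x ∷ x′ ∷ xs) (y ∷ y′ ∷ ys) → y < y′ → x < x′
OrderIso-ascent (_ , iso) = Equivalence.from (iso zero (suc zero))

OrderIso-++⁻ʳ : ∀ B₁ {s B₂} → OrderIso s (B₁ ++ B₂) →
  ∃₂ λ S₁ S₂ → s ≡ S₁ ++ S₂ × length S₁ ≡ length B₁ × OrderIso S₂ B₂
OrderIso-++⁻ʳ []       iso = [] , _ , refl , refl , iso
OrderIso-++⁻ʳ (_ ∷ B₁) {[]}    (() , _)
OrderIso-++⁻ʳ (_ ∷ B₁) {x ∷ s} iso
  with S₁ , S₂ , refl , ∣S₁∣ , iso₂ ← OrderIso-++⁻ʳ B₁ {s} (OrderIso-tail iso) =
  x ∷ S₁ , S₂ , refl , cong suc ∣S₁∣ , iso₂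

desc : ℕ → ℕ → List ℕ
desc b zero    = []
desc b (suc m) = suc (b + m) ∷ desc b m

length-desc : ∀ b m → length (desc b m) ≡ m
length-desc b zero    = refl
length-desc b (suc m) = cong suc (length-desc b m)

∈-desc⁻ : ∀ {b m z} → z ∈ desc b m → b < z × z ≤ b + m
∈-desc⁻ {b} {suc m} (here refl) = s≤s (m≤m+n b m) , ≤-reflexive (sym (+-suc b m))
∈-desc⁻ {b} {suc m} (there z∈) with b<z , z≤b+m ← ∈-desc⁻ z∈ =
  b<z , ≤-trans z≤b+m (+-monoʳ-≤ b (n≤1+n m))

Descending : List ℕ → Set
Descending = AllPairs _>_

desc-descending : ∀ b m → Descending (desc b m)
desc-descending b zero    = []
desc-descending b (suc m) =
  All.tabulate (λ z∈ → s≤s (proj₂ (∈-desc⁻ z∈))) ∷ desc-descending b m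

desc-++ : ∀ b m p → desc b (m + p) ≡ desc (b + p) m ++ desc b p
desc-++ b zero    p = refl
desc-++ b (suc m) p =
  cong₂ _∷_ (cong suc (x∙yz≈xz∙y b m p)) (desc-++ b m p)

desc-above : ∀ b m → All (b <_) (desc b m)
desc-above b m = All.tabulate (proj₁ ∘ ∈-desc⁻)

∉-desc : ∀ {b z} m → z ≤ b → z ∉ desc b m
∉-desc m z≤b z∈ = <⇒≱ (proj₁ (∈-desc⁻ z∈)) z≤b

desc-⊆ : ∀ b {m n} → m ≤ n → desc b m ⊆ desc b n
desc-⊆ b {m} {n} m≤n =
  subst (desc b m ⊆_) (trans (sym (desc-++ b (n ∸ m) m)) (cong (desc b) (m∸n+n≡m m≤n)))
        (++⁺ˡ _ ⊆-refl)

desc-⊆-+ : ∀ b m p → desc (b + p) m ⊆ desc b (m + p)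
desc-⊆-+ b m p = subst (desc (b + p) m ⊆_) (sym (desc-++ b m p)) (++⁺ʳ _ ⊆-refl)

desc-downFrom : ∀ n → desc 0 n ≡ map suc (downFrom n)
desc-downFrom zero    = refl
desc-downFrom (suc n) = cong (suc n ∷_) (desc-downFrom n)

upTo↭desc : ∀ n → map suc (upTo n) ↭ desc 0 n
upTo↭desc n = begin
  map suc (upTo n)            ↭⟨ ↭-reverse _ ⟨
  reverse (map suc (upTo n))  ≡⟨ reverse-map suc (upTo n) ⟨
  map suc (reverse (upTo n))  ≡⟨ cong (map suc) (reverse-upTo n) ⟩
  map suc (downFrom n)        ≡⟨ desc-downFrom n ⟨
  desc 0 n                    ∎
  where open PermutationReasoning

upTo-suc↭ : ∀ m → map suc (upTo (suc m)) ↭ 1 ∷ desc 1 m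
upTo-suc↭ m = begin
  map suc (upTo (suc m))  ↭⟨ upTo↭desc (suc m) ⟩
  desc 0 (suc m)          ≡⟨ cong (desc 0) (+-comm 1 m) ⟩
  desc 0 (m + 1)          ≡⟨ desc-++ 0 m 1 ⟩
  desc 1 m ++ [ 1 ]       ↭⟨ ∷↭∷ʳ 1 (desc 1 m) ⟨
  1 ∷ desc 1 m            ∎
  where open PermutationReasoning

applyUpTo-∸ : ∀ b m → applyUpTo ((m + b) ∸_) m ≡ desc b m
applyUpTo-∸ b zero    = refl
applyUpTo-∸ b (suc m) = cong₂ _∷_ (cong suc (+-comm m b)) (applyUpTo-∸ b m)

down≡desc : ∀ b m → down (m + b) b ≡ desc b m
down≡desc b m = begin
  map ((m + b) ∸_) (upTo (m + b ∸ b))  ≡⟨ cong (map ((m + b) ∸_) ∘ upTo) (m+n∸n≡m m b) ⟩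
  map ((m + b) ∸_) (upTo m)            ≡⟨ map-upTo ((m + b) ∸_) m ⟩
  applyUpTo ((m + b) ∸_) m             ≡⟨ applyUpTo-∸ b m ⟩
  desc b m                             ∎
  where open ≡-Reasoning

-- Patterns of length three

AscentsFrom1 : List ℕ → Set
AscentsFrom1 = AllPairs (λ u v → u < v → u ≡ 1)

ascentsFrom1⇒avoidsT : ∀ {α} → All (1 ≤_) α → AscentsFrom1 α → AvoidsT α
ascentsFrom1⇒avoidsT {α} pos asc = avoid123 , avoid213 , avoid231
  where
  restrict : ∀ {a b c} → a ∷ b ∷ c ∷ [] ⊆ α →
    (1 ≤ a × 1 ≤ b × 1 ≤ c) × (a < b → a ≡ 1) × (a < c → a ≡ 1) × (b < c → b ≡ 1)
  restrict σ with 1≤a ∷ 1≤b ∷ 1≤c ∷ [] ← All-resp-⊆ σ pos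
                | (ab ∷ ac ∷ []) ∷ (bc ∷ []) ∷ _ ← AllPairs-resp-⊆ σ asc =
    (1≤a , 1≤b , 1≤c) , ab , ac , bc

  avoid123 : Avoids α p123
  avoid123 (a ∷ b ∷ c ∷ [] , σ , _ , iso)
    with _ , ab , _ , bc ← restrict σ =
    <-irrefl (trans (ab a<b) (sym (bc b<c))) a<b
    where
    a<b : a < b
    a<b = Equivalence.from (iso (# 0) (# 1)) (s<s z<s)
    b<c : b < c
    b<c = Equivalence.from (iso (# 1) (# 2)) (s<s (s<s z<s))

  avoid213 : Avoids α p213
  avoid213 (a ∷ b ∷ c ∷ [] , σ , _ , iso)
    with (_ , 1≤b , _) , _ , ac , _ ← restrict σ =
    <⇒≱ (subst (b <_) (ac a<c) b<a) 1≤b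
    where
    b<a : b < a
    b<a = Equivalence.from (iso (# 1) (# 0)) (s<s z<s)
    a<c : a < c
    a<c = Equivalence.from (iso (# 0) (# 2)) (s<s (s<s z<s))

  avoid231 : Avoids α p231
  avoid231 (a ∷ b ∷ c ∷ [] , σ , _ , iso)
    with (_ , _ , 1≤c) , ab , _ , _ ← restrict σ =
    <⇒≱ (subst (c <_) (ab a<b) c<a) 1≤c
    where
    a<b : a < b
    a<b = Equivalence.from (iso (# 0) (# 1)) (s<s (s<s z<s))
    c<a : c < a
    c<a = Equivalence.from (iso (# 2) (# 0)) (s<s z<s)

descending⇒ascentsFrom1 : ∀ {xs} → Descending xs → AscentsFrom1 xs
descending⇒ascentsFrom1 = AllPairs.map (λ v<u u<v → contradiction u<v (<-asym v<u))

stretch : ℕ → ℕ → ℕ → ℕ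
stretch a b 0                   = 0
stretch a b 1                   = 1
stretch a b 2                   = a
stretch a b (suc (suc (suc i))) = i + b

stretch-mono : ∀ {a b} → 1 < a → a < b → ∀ {x y} → x < y → stretch a b x < stretch a b y
stretch-mono 1<a a<b {0} {1}                   _ = z<s
stretch-mono 1<a a<b {0} {2}                   _ = <-trans z<s 1<a
stretch-mono 1<a a<b {0} {suc (suc (suc j))}   _ = <-≤-trans (<-trans (<-trans z<s 1<a) a<b) (m≤n+m _ j)
stretch-mono 1<a a<b {1} {1}                   (s<s ())
stretch-mono 1<a a<b {1} {2}                   _ = 1<a
stretch-mono 1<a a<b {1} {suc (suc (suc j))}   _ = <-≤-trans (<-trans 1<a a<b) (m≤n+m _ j)
stretch-mono 1<a a<b {2} {1}                   (s<s ())
stretch-mono 1<a a<b {2} {2}                   (s<s (s<s ()))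
stretch-mono 1<a a<b {2} {suc (suc (suc j))}   _ = <-≤-trans a<b (m≤n+m _ j)
stretch-mono 1<a a<b {suc (suc (suc i))} {suc (suc (suc j))} (s<s (s<s (s<s i<j))) = +-monoˡ-< _ i<j

avoidsT⇒nonIncreasing : ∀ xs ys → (∀ {z} → z ∈ xs ++ ys → 1 < z) →
  AvoidsT (xs ++ 1 ∷ ys) → NonIncreasing (xs ++ ys)
avoidsT⇒nonIncreasing xs ys above1 (avoid123 , avoid213 , avoid231) =
  AllPairs.++⁺ xs≥ ys≥ xs≥ys
  where
  -- (x, y, 1), (1, x, y) and (x, 1, y) are the images of 231, 123 and 213 under stretch x y.
  xs≥ : NonIncreasing xs
  xs≥ = AllPairs-from-⊆ λ σ → ≮⇒≥ λ x<y →
    avoid231 (contains-image (stretch-mono (above1 (∈-++⁺ˡ (Any-resp-⊆ σ (here refl)))) x<y)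
                             (++⁺ σ (refl ∷ minimum ys)))

  ys≥ : NonIncreasing ys
  ys≥ = AllPairs-from-⊆ λ σ → ≮⇒≥ λ x<y →
    avoid123 (contains-image (stretch-mono (above1 (∈-++⁺ʳ xs (Any-resp-⊆ σ (here refl)))) x<y)
                             (++⁺ˡ xs (refl ∷ σ)))

  xs≥ys : All (λ x → All (x ≥_) ys) xs
  xs≥ys = All.tabulate λ x∈ → All.tabulate λ y∈ → ≮⇒≥ λ x<y →
    avoid213 (contains-image (stretch-mono (above1 (∈-++⁺ˡ x∈)) x<y)
                             (++⁺ (from∈ x∈) (refl ∷ from∈ y∈)))

blocks : ℕ → ℕ → List ℕ
blocks p q = desc (suc q) p ++ 1 ∷ desc 1 q

τ≡blocks : ∀ p q → τ (suc (p + q)) (suc q) ≡ blocks p q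
τ≡blocks p q = cong₂ (λ xs ys → xs ++ 1 ∷ ys)
  (trans (cong (λ k → down k (suc q)) (sym (+-suc p q))) (down≡desc (suc q) p))
  (trans (cong (λ k → down k 1) (+-comm 1 q)) (down≡desc 1 q))

blocks-isPerm : ∀ p q → IsPerm (suc (p + q)) (blocks p q)
blocks-isPerm p q = begin
  desc (suc q) p ++ 1 ∷ desc 1 q   ↭⟨ shift 1 (desc (suc q) p) (desc 1 q) ⟩
  1 ∷ desc (suc q) p ++ desc 1 q   ≡⟨ cong (1 ∷_) (desc-++ 1 p q) ⟨
  1 ∷ desc 1 (p + q)               ↭⟨ upTo-suc↭ (p + q) ⟨
  map suc (upTo (suc (p + q)))     ∎
  where open PermutationReasoning

blocks-positive : ∀ p q → All (1 ≤_) (blocks p q)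
blocks-positive p q = All.++⁺ (All.map (≤-trans (s≤s z≤n) ∘ <⇒≤) (desc-above (suc q) p))
                              (≤-refl ∷ All.map <⇒≤ (desc-above 1 q))

blocks-ascentsFrom1 : ∀ p q → AscentsFrom1 (blocks p q)
blocks-ascentsFrom1 p q =
  AllPairs.++⁺ (descending⇒ascentsFrom1 (desc-descending (suc q) p))
               (All.tabulate (λ _ _ → refl) ∷ descending⇒ascentsFrom1 (desc-descending 1 q))
               (All.map (λ q<u → All.tabulate λ v∈ u<v →
                                   contradiction u<v (<-asym (≤-<-trans (lower v∈) q<u)))
                        (desc-above (suc q) p))
  where
  lower : ∀ {v} → v ∈ 1 ∷ desc 1 q → v ≤ suc q
  lower (here refl) = s≤s z≤n
  lower (there v∈)  = proj₂ (∈-desc⁻ v∈)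

blocks-avoidsT : ∀ p q → AvoidsT (blocks p q)
blocks-avoidsT p q = ascentsFrom1⇒avoidsT (blocks-positive p q) (blocks-ascentsFrom1 p q)

⊆-blocks⁻ : ∀ {xs ys p q} → xs ++ 1 ∷ ys ⊆ blocks p q → length xs ≤ p × length ys ≤ q
⊆-blocks⁻ {p = p} {q} σ
  with xs⊆ , ys⊆ ← ⊆-split-at (desc (suc q) p) (∉-desc p (s≤s z≤n)) (∉-desc q ≤-refl) σ =
  subst (_ ≤_) (length-desc _ p) (length-mono-≤ xs⊆) ,
  subst (_ ≤_) (length-desc 1 q) (length-mono-≤ ys⊆)

blocks-⊆⁻ : ∀ {p q p′ q′} → blocks p′ q′ ⊆ blocks p q → p′ ≤ p × q′ ≤ q
blocks-⊆⁻ {p′ = p′} {q′} σ with p′≤p , q′≤q ← ⊆-blocks⁻ σ =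
  subst (_≤ _) (length-desc _ p′) p′≤p , subst (_≤ _) (length-desc 1 q′) q′≤q

blocks-injective : ∀ {p q p′ q′} → blocks p q ≡ blocks p′ q′ → p ≡ p′ × q ≡ q′
blocks-injective {p} {q} eq
  with p≤p′ , q≤q′ ← blocks-⊆⁻ (subst (blocks p q ⊆_) eq ⊆-refl)
  with p′≤p , q′≤q ← blocks-⊆⁻ (subst (_⊆ blocks p q) eq ⊆-refl) =
  ≤-antisym p≤p′ p′≤p , ≤-antisym q≤q′ q′≤q

avoidsT⇒blocks : ∀ {m t} → IsPerm (suc m) t → AvoidsT t →
  ∃₂ λ p q → p + q ≡ m × t ≡ blocks p q
avoidsT⇒blocks {m} t∈Sₙ avoidsT
  with xs , ys , refl ← ∈-∃++ (∈-resp-↭ (↭-sym (↭-trans t∈Sₙ (upTo-suc↭ m))) (here refl)) =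
  length xs , length ys , ∣xs∣+∣ys∣≡m ,
  cong₂ (λ us vs → us ++ 1 ∷ vs) (proj₁ split) (proj₂ split)
  where
  rest↭ : xs ++ ys ↭ desc 1 m
  rest↭ = drop-∷ (↭-trans (↭-sym (shift 1 xs ys)) (↭-trans t∈Sₙ (upTo-suc↭ m)))

  ∣xs∣+∣ys∣≡m : length xs + length ys ≡ m
  ∣xs∣+∣ys∣≡m = trans (sym (length-++ xs)) (trans (↭-length rest↭) (length-desc 1 m))

  rest≡ : xs ++ ys ≡ desc (suc (length ys)) (length xs) ++ desc 1 (length ys)
  rest≡ = begin
    xs ++ ys
      ≡⟨ ↭-nonIncreasing⇒≡
           (avoidsT⇒nonIncreasing xs ys (proj₁ ∘ ∈-desc⁻ ∘ ∈-resp-↭ rest↭) avoidsT)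
           (AllPairs.map <⇒≤ (desc-descending 1 m)) rest↭ ⟩
    desc 1 m
      ≡⟨ cong (desc 1) ∣xs∣+∣ys∣≡m ⟨
    desc 1 (length xs + length ys)
      ≡⟨ desc-++ 1 (length xs) (length ys) ⟩
    desc (suc (length ys)) (length xs) ++ desc 1 (length ys) ∎
    where open ≡-Reasoning

  split : xs ≡ desc (suc (length ys)) (length xs) × ys ≡ desc 1 (length ys)
  split = ++-injective xs _ (sym (length-desc _ _)) rest≡

-- Containment between blocks

raise : ℕ → ℕ → ℕ
raise d 0             = 0
raise d 1             = 1
raise d (suc (suc x)) = suc (suc (x + d))

raise-mono : ∀ d {x y} → x < y → raise d x < raise d y
raise-mono d {0}           {1}           _             = z<s
raise-mono d {0}           {suc (suc y)} _             = z<s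
raise-mono d {1}           {1}           (s<s ())
raise-mono d {1}           {suc (suc y)} _             = s<s z<s
raise-mono d {suc (suc x)} {suc (suc y)} (s<s (s<s x<y)) = s<s (s<s (+-monoˡ-< d x<y))

map-raise-desc : ∀ d b m → map (raise d) (desc (suc b) m) ≡ desc (suc b + d) m
map-raise-desc d b zero    = refl
map-raise-desc d b (suc m) = cong₂ _∷_ (cong (2 +_) (xy∙z≈xz∙y b m d)) (map-raise-desc d b m)

blocks-contains : ∀ {p q p′ q′} → p′ ≤ p → q′ ≤ q →
  Contains (blocks p q) (blocks p′ q′)
blocks-contains {p} {q} {p′} {q′} p′≤p q′≤q with d , refl ← m≤n⇒∃[o]m+o≡n q′≤q =
  contains-image (raise-mono d)
    (subst (_⊆ blocks p (q′ + d)) (sym image)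
           (++⁺ (desc-⊆ _ p′≤p) (refl ∷ desc-⊆-+ 1 q′ d)))
  where
  image : map (raise d) (blocks p′ q′) ≡ desc (suc (q′ + d)) p′ ++ 1 ∷ desc (suc d) q′
  image = trans (map-++ (raise d) (desc (suc q′) p′) (1 ∷ desc 1 q′))
                (cong₂ (λ xs ys → xs ++ 1 ∷ ys)
                       (map-raise-desc d q′ p′) (map-raise-desc d 0 q′))

contains-blocks⇒ : ∀ {p q p′ q′} → 1 ≤ q′ →
  Contains (blocks p q) (blocks p′ q′) → p′ ≤ p × q′ ≤ q
contains-blocks⇒ {p} {q} {p′} {suc c} _ (s , s⊆ , iso)
  with OrderIso-++⁻ʳ (desc (suc (suc c)) p′) {s} iso
... | _  , []         , _    , _    , () , _
... | _  , _ ∷ []     , _    , _    , () , _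
... | S₁ , x ∷ x′ ∷ S , refl , ∣S₁∣ , iso₂
  -- x < x′ is the image of the ascent 1 < q′+1; in blocks p q only the entry 1 starts an ascent.
  with refl ← AllPairs-pair (blocks-ascentsFrom1 p q)
                            (⊆-trans (++⁺ˡ S₁ (refl ∷ refl ∷ minimum S)) s⊆)
                            (OrderIso-ascent iso₂ (s<s z<s))
  with ∣S₁∣≤p , ∣x′∷S∣≤q ← ⊆-blocks⁻ s⊆ =
  subst (_≤ p) (trans ∣S₁∣ (length-desc _ p′)) ∣S₁∣≤p ,
  subst (_≤ q) ∣x′∷S∣ ∣x′∷S∣≤q
  where
  ∣x′∷S∣ : suc (length S) ≡ suc c
  ∣x′∷S∣ = trans (suc-injective (proj₁ iso₂)) (cong suc (length-desc 1 c))

-- Counting the avoiders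

module Avoiders (p′ q′ b : ℕ) (1≤q′ : 1 ≤ q′) where

  m : ℕ
  m = p′ + q′ + b

  withTop withBottom : ℕ → List ℕ
  withTop    p = blocks p (m ∸ p)
  withBottom q = blocks (m ∸ q) q

  avoiders : List (List ℕ)
  avoiders = map withTop (upTo p′) ++ map withBottom (upTo q′)

  p′+q′≤m : p′ + q′ ≤ m
  p′+q′≤m = m≤m+n (p′ + q′) b

  short-top≤m : ∀ {p} → p < p′ → p ≤ m
  short-top≤m p<p′ = <⇒≤ (<-≤-trans p<p′ (≤-trans (m≤m+n p′ q′) p′+q′≤m))

  short-bottom≤m : ∀ {q} → q < q′ → q ≤ m
  short-bottom≤m q<q′ = <⇒≤ (<-≤-trans q<q′ (≤-trans (m≤n+m q′ p′) p′+q′≤m))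

  blocks-avoider : ∀ {p q} → p + q ≡ m → p < p′ ⊎ q < q′ →
    IsPerm (suc m) (blocks p q) × AvoidsT (blocks p q) × Avoids (blocks p q) (blocks p′ q′)
  blocks-avoider {p} {q} p+q≡m short =
    subst (λ k → IsPerm (suc k) (blocks p q)) p+q≡m (blocks-isPerm p q) ,
    blocks-avoidsT p q ,
    λ contains → let p′≤p , q′≤q = contains-blocks⇒ 1≤q′ contains in
      [ (λ p<p′ → <⇒≱ p<p′ p′≤p) , (λ q<q′ → <⇒≱ q<q′ q′≤q) ]′ short

  disjoint : Disjoint (map withTop (upTo p′)) (map withBottom (upTo q′))
  disjoint (σ∈₁ , σ∈₂)
    with p , p∈ , refl ← ∈-map⁻ withTop σ∈₁
    with q , q∈ , eq ← ∈-map⁻ withBottom σ∈₂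
    with _ , m∸p≡q ← blocks-injective eq =
    <-irrefl (trans (cong (p +_) (sym m∸p≡q)) (m+[n∸m]≡n (short-top≤m p<p′)))
             (<-≤-trans (+-mono-< p<p′ (∈-upTo⁻ q∈)) p′+q′≤m)
    where
    p<p′ : p < p′
    p<p′ = ∈-upTo⁻ p∈

  unique : Unique avoiders
  unique = Unique.++⁺ (Unique.map⁺ (proj₁ ∘ blocks-injective) (Unique.upTo⁺ p′))
                      (Unique.map⁺ (proj₂ ∘ blocks-injective) (Unique.upTo⁺ q′))
                      disjoint

  ∈avoiders⇔ : ∀ σ →
    σ ∈ avoiders ⇔ (IsPerm (suc m) σ × AvoidsT σ × Avoids σ (blocks p′ q′))
  ∈avoiders⇔ σ = mk⇔ to from
    where
    to : σ ∈ avoiders → IsPerm (suc m) σ × AvoidsT σ × Avoids σ (blocks p′ q′)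
    to σ∈ with ∈-++⁻ (map withTop (upTo p′)) σ∈
    ... | inj₁ σ∈₁ with p , p∈ , refl ← ∈-map⁻ withTop σ∈₁ =
      blocks-avoider (m+[n∸m]≡n (short-top≤m (∈-upTo⁻ p∈))) (inj₁ (∈-upTo⁻ p∈))
    ... | inj₂ σ∈₂ with q , q∈ , refl ← ∈-map⁻ withBottom σ∈₂ =
      blocks-avoider (m∸n+n≡m (short-bottom≤m (∈-upTo⁻ q∈))) (inj₂ (∈-upTo⁻ q∈))

    from : IsPerm (suc m) σ × AvoidsT σ × Avoids σ (blocks p′ q′) → σ ∈ avoiders
    from (σ∈Sₙ , avoidsT , avoidsβ) with p , q , p+q≡m , refl ← avoidsT⇒blocks σ∈Sₙ avoidsT
      with p <? p′ | q <? q′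
    ... | yes p<p′ | _ =
      ∈-++⁺ˡ (subst (_∈ _) (cong (blocks p) q≡m∸p) (∈-map⁺ withTop (∈-upTo⁺ p<p′)))
      where
      q≡m∸p : m ∸ p ≡ q
      q≡m∸p = trans (cong (_∸ p) (sym p+q≡m)) (m+n∸m≡n p q)
    ... | no _     | yes q<q′ =
      ∈-++⁺ʳ _ (subst (_∈ _) (cong (λ k → blocks k q) p≡m∸q)
                      (∈-map⁺ withBottom (∈-upTo⁺ q<q′)))
      where
      p≡m∸q : m ∸ q ≡ p
      p≡m∸q = trans (cong (_∸ q) (sym p+q≡m)) (m+n∸n≡m p q)
    ... | no p≮p′  | no q≮q′ =
      contradiction (blocks-contains (≮⇒≥ p≮p′) (≮⇒≥ q≮q′)) avoidsβ

  length-avoiders : length avoiders ≡ p′ + q′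
  length-avoiders = begin
    length avoiders  ≡⟨ length-++ (map withTop (upTo p′)) ⟩
    length (map withTop (upTo p′)) + length (map withBottom (upTo q′))
      ≡⟨ cong₂ _+_ (trans (length-map withTop (upTo p′)) (length-upTo p′))
                   (trans (length-map withBottom (upTo q′)) (length-upTo q′)) ⟩
    p′ + q′  ∎
    where open ≡-Reasoning

  cardAvoiders : CardAvoiders (suc m) (blocks p′ q′) (p′ + q′)
  cardAvoiders = avoiders , unique , ∈avoiders⇔ , length-avoiders

theorem7 :
    ((k : ℕ) → 1 ≤ k → (t : List ℕ) → IsPerm k t → AvoidsT t →
      ∃ λ r → 1 ≤ r × r ≤ k × t ≡ τ k r)
    ×
    ((k r n : ℕ) → 2 ≤ r → r ≤ k → k ≤ n → CardAvoiders n (τ k r) (k ∸ 1))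
theorem7 = classification , enumeration
  where
  classification : (k : ℕ) → 1 ≤ k → (t : List ℕ) → IsPerm k t → AvoidsT t →
    ∃ λ r → 1 ≤ r × r ≤ k × t ≡ τ k r
  classification (suc m) _ t t∈Sₖ avoidsT
    with p , q , refl , refl ← avoidsT⇒blocks t∈Sₖ avoidsT =
    suc q , s≤s z≤n , s≤s (m≤n+m q p) , sym (τ≡blocks p q)

  enumeration : (k r n : ℕ) → 2 ≤ r → r ≤ k → k ≤ n → CardAvoiders n (τ k r) (k ∸ 1)
  enumeration (suc k) (suc q) n (s≤s 1≤q) (s≤s q≤k) k<n
    with p , refl ← m≤n⇒∃[o]m+o≡n q≤k
    with b , refl ← m≤n⇒∃[o]m+o≡n k<n
    rewrite +-comm q p | τ≡blocks p q = Avoiders.cardAvoiders p q b 1≤q
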